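{- Let $M$ be a Turing machine and let $\mathcal{H}_M$ be as in the context. Then $\operatorname{Tdim}(\mathcal{H}_M)=K$ if $M$ halts after exactly $K\in\mathbb{N}$ steps on the empty input, and $\operatorname{Tdim}(\mathcal{H}_M)=\infty$ otherwise.
   Context: $\mathbb{N}=\{0,1,2,\dots\}$. Let $c_c(\{0,1\})$ be the set of finitely supported sequences $a:\mathbb{N}\to\{0,1\}$. For a Turing machine $M$ and $a\in c_c(\{0,1\})$, define $h_a:\mathbb{N}\to\{0,1\}$ by $h_a(n)=a(n)$ if $M$ does not halt after $\le n$ steps on the empty input, and $h_a(n)=0$ otherwise; $\mathcal{H}_M=\{h_a: a\in c_c(\{0,1\})\}$. For $g\in\mathcal{G}\subseteq\{0,1\}^{\mathbb{N}}$, a (possibly infinite) $S\subseteq\mathbb{N}\times\{0,1\}$ is a teaching set for $g$ if $g(x)=y$ for all $(x,y)\in S$ and every $\tilde g\in\mathcal{G}\setminus\{g\}$ has $\tilde g(x)\ne y$ for some $(x,y)\in S$; $\operatorname{Tdim}(\mathcal{G})=\sup_{g\in\mathcal{G}}\inf\{|S|: S\text{ a teaching set for }g\}$. -}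

module Defs where

open import Data.Nat using (ℕ; zero; suc; _≤_; _<_)
open import Data.Bool using (Bool; true; false; if_then_else_)
open import Data.Fin using (Fin)
open import Data.Integer using (ℤ; _+_; _-_; 1ℤ; 0ℤ; _≟_)
open import Data.Maybe using (Maybe; just; nothing; _>>=_; is-nothing)
open import Data.Product using (Σ; _×_; _,_)
open import Data.List using (List; length; upTo)
open import Data.Bool.ListAction using (any)
open import Data.List.Membership.Propositional using (_∈_)
open import Relation.Nullary using (¬_; does)
open import Relation.Binary.PropositionalEquality using (_≡_; _≗_)

-- The machine
-- halts when the transition function is undefined (returns nothing).

data Move : Set where
  L R : Move

record TM : Set where
  field
    nStates  : ℕ      -- states are Fin (suc nStates), start state zero
    nSymbols : ℕ      -- symbols are Fin (suc nSymbols), blank = zero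
    δ : Fin (suc nStates) → Fin (suc nSymbols) →
        Maybe (Fin (suc nStates) × Fin (suc nSymbols) × Move)

record Config (M : TM) : Set where
  constructor conf
  field
    state : Fin (suc (TM.nStates M))
    head  : ℤ
    tape  : ℤ → Fin (suc (TM.nSymbols M))

initConf : (M : TM) → Config M
initConf M = conf Fin.zero 0ℤ (λ _ → Fin.zero)

move : Move → ℤ → ℤ
move L i = i - 1ℤ
move R i = i + 1ℤ

step : (M : TM) → Config M → Maybe (Config M)
step M (conf q h t) with TM.δ M q (t h)
... | nothing = nothing
... | just (q' , s , m) =
  just (conf q' (move m h) (λ i → if does (i ≟ h) then s else t i))

-- configuration after n steps on the empty input (nothing if halted earlier)
run : (M : TM) → ℕ → Maybe (Config M)
run M zero    = just (initConf M)
run M (suc n) = run M n >>= step M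

haltsExactly? : TM → ℕ → Bool
haltsExactly? M K with run M K
... | nothing = false
... | just c  = is-nothing (step M c)

HaltsExactly : TM → ℕ → Set
HaltsExactly M K = haltsExactly? M K ≡ true

haltsWithin? : TM → ℕ → Bool
haltsWithin? M n = any (haltsExactly? M) (upTo (suc n))

FinSupp : (ℕ → Bool) → Set
FinSupp a = Σ ℕ λ N → ∀ n → N ≤ n → a n ≡ false

h : TM → (ℕ → Bool) → ℕ → Bool
h M a n = if haltsWithin? M n then false else a n

-- membership in H_M = { h_a : a ∈ c_c({0,1}) } (functions compared extensionally)
H : TM → (ℕ → Bool) → Set
H M g = Σ (ℕ → Bool) λ a → FinSupp a × (g ≗ h M a)

Class : Set₁
Class = (ℕ → Bool) → Set

SubsetNB : Set₁
SubsetNB = ℕ → Bool → Set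

CardLe : SubsetNB → ℕ → Set
CardLe S m = Σ (List (ℕ × Bool)) λ xs →
  (length xs ≤ m) × (∀ x y → S x y → (x , y) ∈ xs)

TeachingSet : Class → (ℕ → Bool) → SubsetNB → Set
TeachingSet G g S =
  (∀ x y → S x y → g x ≡ y) ×
  (∀ g̃ → G g̃ → ¬ (g̃ ≗ g) → Σ ℕ λ x → Σ Bool λ y → S x y × ¬ (g̃ x ≡ y))

-- inf { |S| : S teaching set for g } > m
TeachLowerGt : Class → (ℕ → Bool) → ℕ → Set₁
TeachLowerGt G g m = ∀ S → TeachingSet G g S → ¬ CardLe S m

-- Tdim(G) = K  (K ∈ ℕ): sup_g inf_S |S| = K
TdimIs : Class → ℕ → Set₁
TdimIs G K =
  (∀ g → G g → Σ SubsetNB λ S → TeachingSet G g S × CardLe S K) ×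
  (∀ m → m < K → Σ (ℕ → Bool) λ g → G g × TeachLowerGt G g m)

TdimInfinite : Class → Set₁
TdimInfinite G = ∀ m → Σ (ℕ → Bool) λ g → G g × TeachLowerGt G g m

module Submission where

-- If M halts after exactly K steps, every member of H_M vanishes from K on, so it is
-- determined by its K values below K, which therefore form a teaching set.  Conversely,
-- the indicator of each x < K lies in H_M and differs from the zero function only at x,
-- so every teaching set for the zero function contains all K pairs (x, 0) with x < K.
-- If M never halts, every indicator lies in H_M and teaching sets for 0 are unbounded.

open import Defs
open import Data.Nat using (ℕ; suc; s≤s; _≤_; _<_; _≤′_; ≤′-refl; ≤′-step; _≟_; _≡ᵇ_)
open import Data.Nat.Properties using (≡ᵇ⇒≡; ≡⇒≡ᵇ; ≤-reflexive; ≤-pred; ≤-<-trans; <⇒≢; ≤⇒≯; <-irrefl; <-cmp; ≮⇒≥; ≤⇒≤′; n<1+n; _<?_)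
open import Data.Bool as Bool using (Bool; true; false; T)
open import Data.Bool.Properties using (T-≡; ¬-not; if-eta)
open import Data.Fin using (Fin; toℕ; fromℕ<)
open import Data.Fin.Properties using (toℕ<n; toℕ-fromℕ<; toℕ-injective; injective⇒≤; ¬∀⟶∃¬)
open import Data.Maybe using (just; nothing)
open import Data.Product using (Σ; _×_; _,_; proj₁; proj₂)
open import Data.List using (List; length; map; upTo; lookup)
open import Data.List.Properties using (length-map; length-upTo)
open import Data.List.Relation.Unary.Any using (index)
open import Data.List.Relation.Unary.Any.Properties using (any⁺; any⁻; lookup-index)
open import Data.List.Membership.Propositional using (_∈_; lose; find)
open import Data.List.Membership.Propositional.Properties using (∈-upTo⁺; ∈-upTo⁻; ∈-map⁺)
open import Data.Empty using (⊥-elim)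
open import Function using (const; Injective; Equivalence)
open import Relation.Binary.Definitions using (tri<; tri≈; tri>)
open import Relation.Nullary using (¬_; yes; no)
open import Relation.Binary.PropositionalEquality using (_≡_; _≢_; ≢-sym; _≗_; refl; sym; trans; cong; subst; module ≡-Reasoning)

module _ (M : TM) where

  run-halted : ∀ {m n} → run M m ≡ nothing → m ≤′ n → run M n ≡ nothing
  run-halted halted ≤′-refl = halted
  run-halted halted (≤′-step m≤′n) rewrite run-halted halted m≤′n = refl

  haltsExactly⇒halted : ∀ K → HaltsExactly M K → run M (suc K) ≡ nothing
  haltsExactly⇒halted K hK with run M K
  haltsExactly⇒halted K () | nothing
  ... | just c with step M c
  haltsExactly⇒halted K () | just c | just _
  ... | nothing = refl

  halted⇒¬haltsExactly : ∀ K → run M K ≡ nothing → ¬ HaltsExactly M K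
  halted⇒¬haltsExactly K halted hK with run M K
  halted⇒¬haltsExactly K refl () | nothing

  haltsExactly-unique : ∀ {j K} → HaltsExactly M j → HaltsExactly M K → j ≡ K
  haltsExactly-unique {j} {K} hj hK with <-cmp j K
  ... | tri≈ _ j≡K _ = j≡K
  ... | tri< j<K _ _ =
    ⊥-elim (halted⇒¬haltsExactly K (run-halted (haltsExactly⇒halted j hj) (≤⇒≤′ j<K)) hK)
  ... | tri> _ _ K<j =
    ⊥-elim (halted⇒¬haltsExactly j (run-halted (haltsExactly⇒halted K hK) (≤⇒≤′ K<j)) hj)

  haltsWithin?-after : ∀ {K n} → HaltsExactly M K → K ≤ n → haltsWithin? M n ≡ true
  haltsWithin?-after hK K≤n =
    Equivalence.to T-≡
      (any⁺ (haltsExactly? M) (lose (∈-upTo⁺ (s≤s K≤n)) (Equivalence.from T-≡ hK)))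

  ¬haltsWithin? : ∀ n → (∀ j → j ≤ n → ¬ HaltsExactly M j) → haltsWithin? M n ≡ false
  ¬haltsWithin? n none = ¬-not λ within →
    let j , j∈ , hj = find (any⁻ (haltsExactly? M) (upTo (suc n)) (Equivalence.from T-≡ within))
    in none j (≤-pred (∈-upTo⁻ j∈)) (Equivalence.to T-≡ hj)

  haltsWithin?-before : ∀ {K n} → HaltsExactly M K → n < K → haltsWithin? M n ≡ false
  haltsWithin?-before hK n<K = ¬haltsWithin? _ λ j j≤n hj →
    <-irrefl (haltsExactly-unique hj hK) (≤-<-trans j≤n n<K)

point : ℕ → ℕ → Bool
point x n = n ≡ᵇ x

point-self≢false : ∀ x → point x x ≢ false
point-self≢false x self≡false = subst T self≡false (≡⇒≡ᵇ x x refl)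

point-elsewhere : ∀ {x n} → n ≢ x → point x n ≡ false
point-elsewhere {x} {n} n≢x = ¬-not λ at-x → n≢x (≡ᵇ⇒≡ n x (Equivalence.from T-≡ at-x))

VanishesFrom : ℕ → (ℕ → Bool) → Set
VanishesFrom K f = ∀ n → K ≤ n → f n ≡ false

agreeBelow⇒≗ : ∀ {K f g} → VanishesFrom K f → VanishesFrom K g →
               (∀ x → x < K → f x ≡ g x) → f ≗ g
agreeBelow⇒≗ {K} vanish-f vanish-g agree x with x <? K
... | yes x<K = agree x x<K
... | no x≮K = trans (vanish-f x (≮⇒≥ x≮K)) (sym (vanish-g x (≮⇒≥ x≮K)))

injection-into-list⇒≤length : ∀ {A : Set} {K} (xs : List A) (f : Fin K → A) →
                              Injective _≡_ _≡_ f → (∀ i → f i ∈ xs) → K ≤ length xs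
injection-into-list⇒≤length xs f f-injective f∈xs = injective⇒≤ position-injective
  where
  position-injective : Injective _≡_ _≡_ (λ i → index (f∈xs i))
  position-injective {i} {j} same = f-injective (begin
    f i                          ≡⟨ lookup-index (f∈xs i) ⟩
    lookup xs (index (f∈xs i))   ≡⟨ cong (lookup xs) same ⟩
    lookup xs (index (f∈xs j))   ≡⟨ lookup-index (f∈xs j) ⟨
    f j                          ∎)
    where open ≡-Reasoning

teachingSet-∋-isolated : ∀ {G g S g̃ x} → TeachingSet G g S → G g̃ →
                         g̃ x ≢ g x → (∀ n → n ≢ x → g̃ n ≡ g n) → S x (g x)
teachingSet-∋-isolated {g = g} {S} {x = x} (consistent , separates) g̃∈G differs agrees
  with separates _ g̃∈G (λ g̃≗g → differs (g̃≗g x))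
... | n , y , Sny , g̃n≢y with n ≟ x
...   | yes refl = subst (S n) (sym (consistent n y Sny)) Sny
...   | no n≢x = ⊥-elim (g̃n≢y (trans (agrees n n≢x) (consistent n y Sny)))

teachLowerGt-const-false : ∀ {G K m} → (∀ x → x < K → G (point x)) →
                           m < K → TeachLowerGt G (const false) m
teachLowerGt-const-false {K = K} point∈G m<K S teaching (xs , |xs|≤m , S⊆xs) =
  ≤⇒≯ (injection-into-list⇒≤length xs pair pair-injective pair∈xs) (≤-<-trans |xs|≤m m<K)
  where
  pair : Fin K → ℕ × Bool
  pair i = toℕ i , false
  pair-injective : Injective _≡_ _≡_ pair
  pair-injective same = toℕ-injective (cong proj₁ same)
  pair∈xs : ∀ i → pair i ∈ xs
  pair∈xs i = S⊆xs (toℕ i) false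
    (teachingSet-∋-isolated teaching (point∈G (toℕ i) (toℕ<n i))
                            (point-self≢false (toℕ i)) (λ _ → point-elsewhere))

graphBelow : ℕ → (ℕ → Bool) → SubsetNB
graphBelow K g x y = x < K × g x ≡ y

graphBelow-cardLe : ∀ K g → CardLe (graphBelow K g) K
graphBelow-cardLe K g =
  map (λ x → x , g x) (upTo K) ,
  ≤-reflexive (trans (length-map _ (upTo K)) (length-upTo K)) ,
  λ { x _ (x<K , refl) → ∈-map⁺ _ (∈-upTo⁺ x<K) }

graphBelow-teachingSet : ∀ {G K g} → (∀ f → G f → VanishesFrom K f) → G g →
                         TeachingSet G g (graphBelow K g)
graphBelow-teachingSet {G} {K} {g} vanish g∈G = (λ _ _ → proj₂) , separates
  where
  separates : ∀ g̃ → G g̃ → ¬ (g̃ ≗ g) → Σ ℕ λ x → Σ Bool λ y → graphBelow K g x y × g̃ x ≢ y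
  separates g̃ g̃∈G g̃≢g =
    let i , differs = ¬∀⟶∃¬ K _ (λ i → g̃ (toℕ i) Bool.≟ g (toℕ i)) λ agree →
          g̃≢g (agreeBelow⇒≗ (vanish g̃ g̃∈G) (vanish g g∈G) λ x x<K →
            subst (λ n → g̃ n ≡ g n) (toℕ-fromℕ< x<K) (agree (fromℕ< x<K)))
    in toℕ i , g (toℕ i) , (toℕ<n i , refl) , differs

module _ (M : TM) where

  H-const-false : H M (const false)
  H-const-false = const false , (0 , λ _ _ → refl) , λ n → sym (if-eta (haltsWithin? M n))

  H-point : ∀ {x} → haltsWithin? M x ≡ false → H M (point x)
  H-point {x} running = point x , (suc x , λ n x<n → point-elsewhere (≢-sym (<⇒≢ x<n))) , keep
    where
    keep : ∀ n → point x n ≡ h M (point x) n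
    keep n with n ≟ x
    ... | yes refl rewrite running = refl
    ... | no n≢x rewrite point-elsewhere n≢x = sym (if-eta (haltsWithin? M n))

  H-vanishesFrom : ∀ {K f} → HaltsExactly M K → H M f → VanishesFrom K f
  H-vanishesFrom hK (a , _ , f≗ha) n K≤n rewrite f≗ha n | haltsWithin?-after M hK K≤n = refl

proposition3p8 : (M : TM) →
    (∀ K → HaltsExactly M K → TdimIs (H M) K) ×
    ((∀ K → ¬ HaltsExactly M K) → TdimInfinite (H M))
proposition3p8 M = halting , nonHalting
  where
  halting : ∀ K → HaltsExactly M K → TdimIs (H M) K
  halting K hK =
    (λ g g∈H → graphBelow K g ,
               graphBelow-teachingSet (λ _ → H-vanishesFrom M hK) g∈H ,
               graphBelow-cardLe K g) ,
    λ m m<K → const false , H-const-false M ,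
              teachLowerGt-const-false
                (λ x x<K → H-point M (haltsWithin?-before M hK x<K)) m<K

  nonHalting : (∀ K → ¬ HaltsExactly M K) → TdimInfinite (H M)
  nonHalting never m = const false , H-const-false M ,
    teachLowerGt-const-false
      (λ x _ → H-point M (¬haltsWithin? M x λ j _ → never j)) (n<1+n m)
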